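{- Let $k\geqslant2$ be an integer and let $q_k=p_1p_2\cdots p_k$ be the product of the first $k$ primes. Then the only positive integer $n$ with $t(n+j)=t(q_k+j)$ for all $0\leqslant j\leqslant q_k-1$ is $n=q_k$; i.e. $|O(q_k,q_k+1,\ldots,2q_k-1)|=1$.
   Context: For $n\ge1$, $t(n)$ is the rooted planar tree of $n$: $t(1)$ is the single-vertex tree; if $n=p_1^{a_1}\cdots p_s^{a_s}$ with primes $p_1<\dots<p_s$ and $a_i\ge1$, then $t(n)$ is a root with $s$ edges ordered left to right, the $i$-th edge leading to a copy of $t(a_i)$. -}

module Defs where

open import Data.Nat using (ℕ; zero; suc; _+_; _*_; _∸_; _/_; _<_; _≤_; _!)
open import Data.Nat.Divisibility using (_∣?_)
open import Data.Nat.Primality using (prime?)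

open import Data.List using (List; []; _∷_; map; filter; applyUpTo; upTo)
open import Data.Nat.ListAction using (product)
open import Relation.Nullary.Decidable using (does)
open import Data.Bool using (if_then_else_)

-- Rooted planar trees: a root with an ordered (left-to-right) list of subtrees.
data Tree : Set where
  node : List Tree → Tree

-- multiplicity of p in n (with fuel f; fuel n suffices). Returns 0 for p < 2 or n = 0.
mult : ℕ → ℕ → ℕ → ℕ
mult zero p n = 0
mult (suc f) 0 n = 0
mult (suc f) 1 n = 0
mult (suc f) p@(suc (suc _)) zero = 0
mult (suc f) p@(suc (suc _)) n@(suc _) =
  if does (p ∣? n) then suc (mult f p (n / p)) else 0

exponents : ℕ → List ℕ
exponents n = map (λ p → mult n p n) (filter (λ p → p ∣? n) (filter prime? (applyUpTo (λ i → 2 + i) (n ∸ 1))))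

-- t with fuel; fuel n suffices for t(n) since every exponent of n is < n
tAux : ℕ → ℕ → Tree
tAux zero n = node []
tAux (suc f) n = node (map (tAux f) (exponents n))

-- t(n) as in the paper (t(1) = single vertex; t(0) is irrelevant)
t : ℕ → Tree
t n = tAux n n

-- smallest prime in (n, n! + 1]; such a prime always exists (Euclid)
nextPrime : ℕ → ℕ
nextPrime n with filter prime? (applyUpTo (λ i → suc n + i) ((n !) ∸ n + 1))
... | [] = (n !) + 1
... | p ∷ _ = p

-- nthPrime i = p_(i+1): p_1 = 2, p_2 = 3, ...
nthPrime : ℕ → ℕ
nthPrime zero = 2
nthPrime (suc i) = nextPrime (nthPrime i)

primorial : ℕ → ℕ
primorial k = product (map nthPrime (upTo k))

-- Write q = q_k, choose j < q with q ∣ n + j, and put N = n + j, M = q + j, so that t N = t M.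
-- The root of t X has ω X children (ω X = number of distinct prime factors of X), and all of
-- them are leaves exactly when X is squarefree. Since X ≥ q_(ω X) for every X ≥ 1, the bound
-- M < 2q ≤ q_(k+1) gives ω M ≤ k, while q ∣ N gives ω N ≥ k, so ω M = ω N = k. A square
-- p² ∣ M would force M ≥ p · rad M ≥ 2q; so M is squarefree, hence so is N, and a squarefree
-- multiple of q with only k prime factors is q itself. Thus n ≤ N = q, and t n = t q gives
-- ω n ≥ k, i.e. n ≥ q.

module Submission where

open import Defs
open import Data.Nat
open import Data.Nat.Properties
open import Data.Nat.Divisibility
open import Data.Nat.DivMod using (m≥n⇒m/n>0)
open import Data.Nat.Primality
open import Data.Nat.Primality.Factorisation using (factorise; factorisationHasAllPrimeFactors)
open import Data.Nat.ListAction using (product)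
open import Data.Nat.ListAction.Properties using (∈⇒∣product)
open import Data.List using (List; []; _∷_; map; filter; applyUpTo; length; _++_)
open import Data.List.Properties using (length-map; length-++-sucʳ)
open import Function using (_∘_)
open import Data.List.Relation.Unary.All as All using (All; []; _∷_)
import Data.List.Relation.Unary.All.Properties as All
open import Data.List.Relation.Unary.AllPairs as AllPairs using (AllPairs; []; _∷_)
import Data.List.Relation.Unary.AllPairs.Properties as AllPairs
open import Data.List.Relation.Unary.Unique.Propositional using (Unique)
open import Data.List.Relation.Unary.Any using (here; there)
open import Data.List.Membership.Propositional using (_∈_)
open import Data.List.Membership.Propositional.Properties
open import Data.List.Relation.Binary.Subset.Propositional using (_⊆_)
open import Data.Product using (∃-syntax; _×_; _,_; proj₁; proj₂)
open import Data.Sum using (inj₁; inj₂)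
open import Relation.Nullary using (¬_; yes; no; contradiction)
open import Relation.Nullary.Decidable using (dec-true; dec-false)
open import Relation.Binary.PropositionalEquality
open import Algebra.Properties.CommutativeSemigroup *-commutativeSemigroup using (x∙yz≈y∙xz)

private
  variable
    A : Set
    j k m n p x X Y : ℕ
    xs ys : List A

-- Primes and Euclid's bound

∃-prime∣ : ∀ m → .{{NonTrivial m}} → ∃[ p ] Prime p × p ∣ m
∃-prime∣ m with factorise m {{nonTrivial⇒nonZero m}}
... | record { factors = [] ; isFactorisation = m≡1 } = contradiction m≡1 nonTrivial⇒≢1
... | record { factors = p ∷ ps ; isFactorisation = m≡p*ps ; factorsPrime = p-prime ∷ _ } =
  p , p-prime , subst (p ∣_) (sym m≡p*ps) (m∣m*n (product ps))

prime⇒2≤ : Prime p → 2 ≤ p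
prime⇒2≤ {p} p-prime = nonTrivial⇒n>1 p {{prime⇒nonTrivial p-prime}}

prime∣prime⇒≡ : ∀ {q} → Prime q → Prime p → q ∣ p → q ≡ p
prime∣prime⇒≡ q-prime p-prime q∣p with prime⇒irreducible p-prime q∣p
... | inj₁ refl = contradiction q-prime ¬prime[1]
... | inj₂ q≡p = q≡p

n∣n! : ∀ n → .{{NonZero n}} → n ∣ n !
n∣n! (suc n) = m∣m*n (n !)

n≤n! : ∀ n → n ≤ n !
n≤n! zero = z≤n
n≤n! (suc n) = m≤m*n (suc n) (n !) {{n !≢0}}

∃prime-between : ∀ n → ∃[ p ] Prime p × n < p × p ≤ n ! + 1
∃prime-between n with ∃-prime∣ (n ! + 1) {{n>1⇒nonTrivial (+-monoˡ-≤ 1 (1≤n! n))}}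
... | p , p-prime , p∣n!+1 with n <? p
...   | yes n<p = p , p-prime , n<p , ∣⇒≤ {{>-nonZero (m≤n+m 1 (n !))}} p∣n!+1
...   | no n≮p = contradiction (∣1⇒≡1 p∣1) (nonTrivial⇒≢1 {{prime⇒nonTrivial p-prime}})
  where
  p∣1 : p ∣ 1
  p∣1 = ∣m+n∣m⇒∣n p∣n!+1 (∣-trans (n∣n! p {{prime⇒nonZero p-prime}}) (m≤n⇒m!∣n! (≮⇒≥ n≮p)))

-- The sequence of primes and the primorials

-- Literally the list searched by nextPrime, so that a 'with' on it unfolds nextPrime n.
candidates : ℕ → List ℕ
candidates n = applyUpTo (λ i → suc n + i) ((n !) ∸ n + 1)

∈-candidates⁺ : n < x → x ≤ n ! + 1 → x ∈ candidates n
∈-candidates⁺ {n} {x} n<x x≤n!+1 =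
  subst (_∈ candidates n) (m+[n∸m]≡n n<x) (∈-applyUpTo⁺ (suc n +_) i<len)
  where
  i<len : x ∸ suc n < n ! ∸ n + 1
  i<len = begin-strict
    x ∸ suc n       ≤⟨ ∸-monoˡ-≤ (suc n) x≤n!+1 ⟩
    n ! + 1 ∸ suc n ≡⟨ cong (_∸ suc n) (+-comm (n !) 1) ⟩
    n ! ∸ n         <⟨ n<1+n (n ! ∸ n) ⟩
    suc (n ! ∸ n)   ≡⟨ +-comm 1 (n ! ∸ n) ⟩
    n ! ∸ n + 1     ∎
    where open ≤-Reasoning

∈-candidates⁻ : x ∈ candidates n → n < x × x ≤ n ! + 1
∈-candidates⁻ {x} {n} x∈ with ∈-applyUpTo⁻ (suc n +_) x∈
... | i , i<len , refl = s≤s (m≤m+n n i) , (begin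
  suc n + i             ≤⟨ +-monoʳ-≤ (suc n) (≤-pred (subst (i <_) (+-comm (n ! ∸ n) 1) i<len)) ⟩
  suc (n + (n ! ∸ n))   ≡⟨ cong suc (m+[n∸m]≡n (n≤n! n)) ⟩
  suc (n !)             ≡⟨ +-comm 1 (n !) ⟩
  n ! + 1               ∎)
  where open ≤-Reasoning

candidates-sorted : ∀ n → AllPairs _<_ (candidates n)
candidates-sorted n = AllPairs.applyUpTo⁺₁ _ _ (λ i<j _ → +-monoʳ-< (suc n) i<j)

nextPrime-head : ∀ n → ∃[ ps ] filter prime? (candidates n) ≡ nextPrime n ∷ ps
nextPrime-head n with filter prime? (candidates n) in eq
... | p ∷ ps = ps , refl
... | [] with ∃prime-between n
...   | p , p-prime , n<p , p≤n!+1
  with () ← subst (p ∈_) eq (∈-filter⁺ prime? (∈-candidates⁺ n<p p≤n!+1) p-prime)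

nextPrime∈candidates : ∀ n → nextPrime n ∈ candidates n × Prime (nextPrime n)
nextPrime∈candidates n with ps , eq ← nextPrime-head n =
  ∈-filter⁻ prime? {xs = candidates n} (subst (nextPrime n ∈_) (sym eq) (here refl))

nextPrime-prime : ∀ n → Prime (nextPrime n)
nextPrime-prime n = proj₂ (nextPrime∈candidates n)

nextPrime-bounds : ∀ n → n < nextPrime n × nextPrime n ≤ n ! + 1
nextPrime-bounds n = ∈-candidates⁻ {n = n} (proj₁ (nextPrime∈candidates n))

nextPrime-least : Prime p → n < p → nextPrime n ≤ p
nextPrime-least {p} {n} p-prime n<p with p ≤? n ! + 1
... | no p≰n!+1 = ≤-trans (proj₂ (nextPrime-bounds n)) (<⇒≤ (≰⇒> p≰n!+1))
... | yes p≤n!+1 with ps , eq ← nextPrime-head n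
  with sorted ← subst (AllPairs _<_) eq (AllPairs.filter⁺ prime? (candidates-sorted n))
  with subst (p ∈_) eq (∈-filter⁺ prime? (∈-candidates⁺ n<p p≤n!+1) p-prime)
... | here refl = ≤-refl
... | there p∈ps = <⇒≤ (All.lookup (AllPairs.head sorted) p∈ps)

nthPrime-prime : ∀ i → Prime (nthPrime i)
nthPrime-prime zero = prime[2]
nthPrime-prime (suc i) = nextPrime-prime (nthPrime i)

nthPrime<nthPrime-suc : ∀ i → nthPrime i < nthPrime (suc i)
nthPrime<nthPrime-suc i = proj₁ (nextPrime-bounds (nthPrime i))

primesFrom : ℕ → ℕ → List ℕ
primesFrom i zero = []
primesFrom i (suc s) = nthPrime i ∷ primesFrom (suc i) s

map-nthPrime-applyUpTo : ∀ s i (f : ℕ → ℕ) → (∀ l → f l ≡ i + l) →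
                         map nthPrime (applyUpTo f s) ≡ primesFrom i s
map-nthPrime-applyUpTo zero i f f≗i+ = refl
map-nthPrime-applyUpTo (suc s) i f f≗i+ = cong₂ _∷_
  (cong nthPrime (trans (f≗i+ 0) (+-identityʳ i)))
  (map-nthPrime-applyUpTo s (suc i) (λ l → f (suc l)) (λ l → trans (f≗i+ (suc l)) (+-suc i l)))

primorial≡product-primesFrom : ∀ k → primorial k ≡ product (primesFrom 0 k)
primorial≡product-primesFrom k = cong product (map-nthPrime-applyUpTo k 0 (λ l → l) (λ l → refl))

length-primesFrom : ∀ i s → length (primesFrom i s) ≡ s
length-primesFrom i zero = refl
length-primesFrom i (suc s) = cong suc (length-primesFrom (suc i) s)

primesFrom-prime : ∀ i s → All Prime (primesFrom i s)
primesFrom-prime i zero = []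
primesFrom-prime i (suc s) = nthPrime-prime i ∷ primesFrom-prime (suc i) s

primesFrom-≥ : ∀ i s → All (nthPrime i ≤_) (primesFrom i s)
primesFrom-≥ i zero = []
primesFrom-≥ i (suc s) =
  ≤-refl ∷ All.map (≤-trans (<⇒≤ (nthPrime<nthPrime-suc i))) (primesFrom-≥ (suc i) s)

primesFrom-sorted : ∀ i s → AllPairs _<_ (primesFrom i s)
primesFrom-sorted i zero = []
primesFrom-sorted i (suc s) =
  All.map (<-≤-trans (nthPrime<nthPrime-suc i)) (primesFrom-≥ (suc i) s) ∷ primesFrom-sorted (suc i) s

primesFrom-unique : ∀ i s → Unique (primesFrom i s)
primesFrom-unique i s = AllPairs.map <⇒≢ (primesFrom-sorted i s)

product-primesFrom-mono : ∀ i {s s′} → s ≤ s′ → product (primesFrom i s) ≤ product (primesFrom i s′)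
product-primesFrom-mono i {zero} {s′} _ = productOfPrimes≥1 (primesFrom-prime i s′)
product-primesFrom-mono i {suc s} {suc s′} (s≤s s≤s′) =
  *-monoʳ-≤ (nthPrime i) (product-primesFrom-mono (suc i) s≤s′)

2*product-primesFrom≤ : ∀ i s → 2 * product (primesFrom i s) ≤ product (primesFrom i (suc s))
2*product-primesFrom≤ i zero = *-monoˡ-≤ 1 (prime⇒2≤ (nthPrime-prime i))
2*product-primesFrom≤ i (suc s) = begin
  2 * (pᵢ * product (primesFrom (suc i) s)) ≡⟨ x∙yz≈y∙xz 2 pᵢ _ ⟩
  pᵢ * (2 * product (primesFrom (suc i) s)) ≤⟨ *-monoʳ-≤ pᵢ (2*product-primesFrom≤ (suc i) s) ⟩
  pᵢ * product (primesFrom (suc i) (suc s)) ∎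
  where
  open ≤-Reasoning
  pᵢ = nthPrime i

product-primesFrom-≤ : ∀ i {ps} → AllPairs _<_ ps → All Prime ps → All (nthPrime i ≤_) ps →
                       product (primesFrom i (length ps)) ≤ product ps
product-primesFrom-≤ i [] [] [] = ≤-refl
product-primesFrom-≤ i (p<ps ∷ sorted) (p-prime ∷ primes) (pᵢ≤p ∷ pᵢ≤ps) =
  *-mono-≤ pᵢ≤p (product-primesFrom-≤ (suc i) sorted primes (All.zipWith pᵢ₊₁≤ (p<ps , primes)))
  where
  pᵢ₊₁≤ : ∀ {q} → _ < q × Prime q → nthPrime (suc i) ≤ q
  pᵢ₊₁≤ (p<q , q-prime) = nextPrime-least q-prime (≤-<-trans pᵢ≤p p<q)

-- Distinct prime factors

Unique-⊆⇒length≤ : Unique xs → xs ⊆ ys → length xs ≤ length ys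
Unique-⊆⇒length≤ [] _ = z≤n
Unique-⊆⇒length≤ {xs = x ∷ xs} (x∉xs ∷ unique) xs⊆ys
  with as , bs , refl ← ∈-∃++ (xs⊆ys (here refl)) = begin
  suc (length xs)         ≤⟨ s≤s (Unique-⊆⇒length≤ unique xs⊆as++bs) ⟩
  suc (length (as ++ bs)) ≡⟨ length-++-sucʳ as x bs ⟨
  length (as ++ x ∷ bs)   ∎
  where
  open ≤-Reasoning
  xs⊆as++bs : xs ⊆ as ++ bs
  xs⊆as++bs y∈xs with ∈-++⁻ as (xs⊆ys (there y∈xs))
  ... | inj₁ y∈as = ∈-++⁺ˡ y∈as
  ... | inj₂ (here refl) = contradiction refl (All.lookup x∉xs y∈xs)
  ... | inj₂ (there y∈bs) = ∈-++⁺ʳ as y∈bs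

product-distinctPrimes-∣ : ∀ {ps} → Unique ps → All Prime ps → All (_∣ m) ps → product ps ∣ m
product-distinctPrimes-∣ {m} [] [] [] = 1∣ m
product-distinctPrimes-∣ {m} {p ∷ ps} (p∉ps ∷ unique) (p-prime ∷ primes) (p∣m ∷ ps∣m)
  with divides c m≡c*Πps ← product-distinctPrimes-∣ unique primes ps∣m
  with euclidsLemma c (product ps) p-prime (subst (p ∣_) m≡c*Πps p∣m)
... | inj₂ p∣Πps =
  contradiction (factorisationHasAllPrimeFactors p-prime p∣Πps primes) (All.All¬⇒¬Any p∉ps)
... | inj₁ (divides e c≡e*p) = divides e (begin
  m                    ≡⟨ m≡c*Πps ⟩
  c * product ps       ≡⟨ cong (_* product ps) c≡e*p ⟩
  e * p * product ps   ≡⟨ *-assoc e p (product ps) ⟩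
  e * (p * product ps) ∎)
  where open ≡-Reasoning

-- The list underlying exponents: the children of t X correspond to the prime divisors of X.
primeDivisors : ℕ → List ℕ
primeDivisors X = filter (_∣? X) (filter prime? (applyUpTo (2 +_) (X ∸ 1)))

ω : ℕ → ℕ
ω X = length (primeDivisors X)

radical : ℕ → ℕ
radical X = product (primeDivisors X)

∈-primeDivisors⁻ : p ∈ primeDivisors X → Prime p × p ∣ X
∈-primeDivisors⁻ {X = X} p∈ with p∈candidates , p∣X ← ∈-filter⁻ (_∣? X) p∈ =
  proj₂ (∈-filter⁻ prime? {xs = applyUpTo (2 +_) (X ∸ 1)} p∈candidates) , p∣X

∈-primeDivisors⁺ : .{{NonZero X}} → Prime p → p ∣ X → p ∈ primeDivisors X
∈-primeDivisors⁺ {X@(suc x)} {p} p-prime p∣X =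
  ∈-filter⁺ (_∣? X) (∈-filter⁺ prime? p∈range p-prime) p∣X
  where
  p∈range : p ∈ applyUpTo (2 +_) x
  p∈range = subst (_∈ _) (m+[n∸m]≡n (prime⇒2≤ p-prime))
    (∈-applyUpTo⁺ (2 +_) (∸-monoˡ-< (s≤s (∣⇒≤ p∣X)) (prime⇒2≤ p-prime)))

primeDivisors-sorted : ∀ X → AllPairs _<_ (primeDivisors X)
primeDivisors-sorted X = AllPairs.filter⁺ (_∣? X) (AllPairs.filter⁺ prime?
  (AllPairs.applyUpTo⁺₁ (2 +_) (X ∸ 1) (λ i<j _ → +-monoʳ-< 2 i<j)))

primeDivisors-unique : ∀ X → Unique (primeDivisors X)
primeDivisors-unique X = AllPairs.map <⇒≢ (primeDivisors-sorted X)

primeDivisors-prime : ∀ X → All Prime (primeDivisors X)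
primeDivisors-prime X = All.tabulate (λ p∈ → proj₁ (∈-primeDivisors⁻ {X = X} p∈))

radical∣ : ∀ X → radical X ∣ X
radical∣ X = product-distinctPrimes-∣ (primeDivisors-unique X) (primeDivisors-prime X)
  (All.tabulate (λ p∈ → proj₂ (∈-primeDivisors⁻ {X = X} p∈)))

primorial-mono-≤ : j ≤ k → primorial j ≤ primorial k
primorial-mono-≤ {j} {k} j≤k rewrite primorial≡product-primesFrom j | primorial≡product-primesFrom k =
  product-primesFrom-mono 0 j≤k

2*primorial≤primorial-suc : ∀ k → 2 * primorial k ≤ primorial (suc k)
2*primorial≤primorial-suc k
  rewrite primorial≡product-primesFrom k | primorial≡product-primesFrom (suc k) =
  2*product-primesFrom≤ 0 k

primesFrom-∣-primorial : ∀ k → All (_∣ primorial k) (primesFrom 0 k)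
primesFrom-∣-primorial k rewrite primorial≡product-primesFrom k = All.tabulate ∈⇒∣product

primorial∣⇒primesFrom-∣ : ∀ k → primorial k ∣ X → All (_∣ X) (primesFrom 0 k)
primorial∣⇒primesFrom-∣ k primorial∣X =
  All.map (λ p∣primorial → ∣-trans p∣primorial primorial∣X) (primesFrom-∣-primorial k)

primorial-ω≤radical : ∀ X → primorial (ω X) ≤ radical X
primorial-ω≤radical X rewrite primorial≡product-primesFrom (ω X) =
  product-primesFrom-≤ 0 (primeDivisors-sorted X) (primeDivisors-prime X)
    (All.map prime⇒2≤ (primeDivisors-prime X))

primorial-ω≤ : ∀ X → .{{NonZero X}} → primorial (ω X) ≤ X
primorial-ω≤ X = ≤-trans (primorial-ω≤radical X) (∣⇒≤ (radical∣ X))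

distinctPrimes∣⇒length≤ω : ∀ {ps} → .{{NonZero X}} → Unique ps → All Prime ps → All (_∣ X) ps →
                           length ps ≤ ω X
distinctPrimes∣⇒length≤ω unique primes ps∣X =
  Unique-⊆⇒length≤ unique (λ p∈ps → ∈-primeDivisors⁺ (All.lookup primes p∈ps) (All.lookup ps∣X p∈ps))

primorial∣⇒≤ω : ∀ k → .{{NonZero X}} → primorial k ∣ X → k ≤ ω X
primorial∣⇒≤ω {X} k primorial∣X = subst (_≤ ω X) (length-primesFrom 0 k)
  (distinctPrimes∣⇒length≤ω (primesFrom-unique 0 k) (primesFrom-prime 0 k)
    (primorial∣⇒primesFrom-∣ k primorial∣X))

<primorial-suc⇒ω≤ : ∀ k X → .{{NonZero X}} → X < primorial (suc k) → ω X ≤ k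
<primorial-suc⇒ω≤ k X X<primorial = ≮⇒≥ λ k<ω → <⇒≱ X<primorial (begin
  primorial (suc k) ≤⟨ primorial-mono-≤ k<ω ⟩
  primorial (ω X)   ≤⟨ primorial-ω≤ X ⟩
  X                 ∎)
  where open ≤-Reasoning

-- If X = c p², every prime divisor of X divides c p, so p · rad X ∣ X.
p*primorial-ω≤ : ∀ X → .{{NonZero X}} → Prime p → p * p ∣ X → p * primorial (ω X) ≤ X
p*primorial-ω≤ {p} X p-prime (divides c X≡c*[p*p]) = begin
  p * primorial (ω X) ≤⟨ *-monoʳ-≤ p (primorial-ω≤radical X) ⟩
  p * radical X       ≤⟨ ∣⇒≤ (subst (p * radical X ∣_) X≡p*[c*p] (*-monoʳ-∣ p radical∣c*p)) ⟩
  X                   ∎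
  where
  open ≤-Reasoning
  X≡p*[c*p] : p * (c * p) ≡ X
  X≡p*[c*p] = trans (x∙yz≈y∙xz p c p) (sym X≡c*[p*p])
  divides-c*p : ∀ {q} → q ∈ primeDivisors X → q ∣ c * p
  divides-c*p q∈ with q-prime , q∣X ← ∈-primeDivisors⁻ {X = X} q∈
    with euclidsLemma (c * p) p q-prime (subst (_ ∣_) (trans X≡c*[p*p] (sym (*-assoc c p p))) q∣X)
  ... | inj₁ q∣c*p = q∣c*p
  ... | inj₂ q∣p rewrite prime∣prime⇒≡ q-prime p-prime q∣p = n∣m*n c
  radical∣c*p : radical X ∣ c * p
  radical∣c*p =
    product-distinctPrimes-∣ (primeDivisors-unique X) (primeDivisors-prime X) (All.tabulate divides-c*p)

-- Multiplicities and the trees t X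

mult≡0 : ∀ f p X → ¬ p ∣ X → mult f p X ≡ 0
mult≡0 zero p X _ = refl
mult≡0 (suc f) 0 X _ = refl
mult≡0 (suc f) 1 X _ = refl
mult≡0 (suc f) (2+ p) zero _ = refl
mult≡0 (suc f) (2+ p) (suc x) p∤X rewrite dec-false (2+ p ∣? suc x) p∤X = refl

1≤mult : ∀ f → Prime p → .{{NonZero X}} → p ∣ X → 1 ≤ mult (suc f) p X
1≤mult {0} f p-prime = contradiction p-prime ¬prime[0]
1≤mult {1} f p-prime = contradiction p-prime ¬prime[1]
1≤mult {2+ p} {suc x} f _ p∣X rewrite dec-true (2+ p ∣? suc x) p∣X = s≤s z≤n

mult≡1 : ∀ f → Prime p → .{{NonZero X}} → p ∣ X → ¬ p * p ∣ X → mult (suc f) p X ≡ 1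
mult≡1 {0} f p-prime = contradiction p-prime ¬prime[0]
mult≡1 {1} f p-prime = contradiction p-prime ¬prime[1]
mult≡1 {2+ p} {suc x} f _ p∣X p²∤X rewrite dec-true (2+ p ∣? suc x) p∣X =
  cong suc (mult≡0 f (2+ p) (suc x / 2+ p) (λ p∣X/p → p²∤X (m∣n/o⇒m*o∣n p∣X p∣X/p)))

2≤mult : ∀ f → Prime p → .{{NonZero X}} → p * p ∣ X → 2 ≤ mult (2+ f) p X
2≤mult {0} f p-prime = contradiction p-prime ¬prime[0]
2≤mult {1} f p-prime = contradiction p-prime ¬prime[1]
2≤mult {P@(2+ p)} {X@(suc x)} f p-prime p²∣X rewrite dec-true (P ∣? X) (m*n∣⇒m∣ P P p²∣X) =
  s≤s (1≤mult f p-prime {{>-nonZero (m≥n⇒m/n>0 (∣⇒≤ (m*n∣⇒m∣ P P p²∣X)))}}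
              (m*n∣o⇒m∣o/n P P p²∣X))

leaf : Tree
leaf = node []

children : Tree → List Tree
children (node ts) = ts

Star : Tree → Set
Star T = All (_≡ leaf) (children T)

SquareFree : ℕ → Set
SquareFree X = ∀ {p} → Prime p → ¬ p * p ∣ X

tAux-1 : ∀ f → tAux f 1 ≡ leaf
tAux-1 zero = refl
tAux-1 (suc f) = refl

tAux≢leaf : ∀ f e → 2 ≤ e → tAux (suc f) e ≢ leaf
tAux≢leaf f e 2≤e tAux≡leaf with p , p-prime , p∣e ← ∃-prime∣ e {{n>1⇒nonTrivial 2≤e}}
  with () ← subst (tAux f (mult e p e) ∈_) (cong children tAux≡leaf)
              (∈-map⁺ (tAux f) (∈-map⁺ (λ p → mult e p e)
                (∈-primeDivisors⁺ {{>-nonZero (<-trans z<s 2≤e)}} p-prime p∣e)))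

length-children-t : ∀ X → length (children (t X)) ≡ ω X
length-children-t zero = refl
length-children-t X@(suc x) =
  trans (length-map (tAux x) (exponents X)) (length-map (λ p → mult X p X) (primeDivisors X))

t≡t⇒ω≡ω : t X ≡ t Y → ω X ≡ ω Y
t≡t⇒ω≡ω {X} {Y} tX≡tY = begin
  ω X                       ≡⟨ length-children-t X ⟨
  length (children (t X))   ≡⟨ cong (length ∘ children) tX≡tY ⟩
  length (children (t Y))   ≡⟨ length-children-t Y ⟩
  ω Y                       ∎
  where open ≡-Reasoning

squareFree⇒star : SquareFree X → Star (t X)
squareFree⇒star {zero} _ = []
squareFree⇒star {X@(suc x)} squareFree = All.map⁺ (All.map⁺ (All.tabulate leafChild))
  where
  leafChild : ∀ {p} → p ∈ primeDivisors X → tAux x (mult X p X) ≡ leaf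
  leafChild p∈ with p-prime , p∣X ← ∈-primeDivisors⁻ {X = X} p∈ =
    trans (cong (tAux x) (mult≡1 x p-prime p∣X (squareFree p-prime))) (tAux-1 x)

-- t 0 is a leaf, hence a star, although 0 is not squarefree.
star⇒squareFree : .{{NonZero X}} → Star (t X) → SquareFree X
star⇒squareFree {1} _ p-prime p²∣1 =
  contradiction (∣1⇒≡1 (m*n∣⇒m∣ _ _ p²∣1)) (nonTrivial⇒≢1 {{prime⇒nonTrivial p-prime}})
star⇒squareFree {X@(2+ x)} star {p} p-prime p²∣X =
  tAux≢leaf x (mult X p X) (2≤mult x p-prime p²∣X)
    (All.lookup (All.map⁻ (All.map⁻ star)) (∈-primeDivisors⁺ p-prime (m*n∣⇒m∣ p p p²∣X)))

primorial≢0 : ∀ k → NonZero (primorial k)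
primorial≢0 k =
  subst NonZero (sym (primorial≡product-primesFrom k)) (productOfPrimes≢0 (primesFrom-prime 0 k))

-- The window argument

m≢0⇒m+n≢0 : ∀ m n → .{{NonZero m}} → NonZero (m + n)
m≢0⇒m+n≢0 (suc m) n = _

∃-shift-to-multiple : ∀ q → .{{NonZero q}} → ∀ n → ∃[ j ] j < q × q ∣ n + j
∃-shift-to-multiple q zero = 0 , >-nonZero⁻¹ q , q ∣0
∃-shift-to-multiple q@(suc q′) (suc n) with ∃-shift-to-multiple q n
... | suc j , j+1<q , q∣n+j+1 = j , <-trans (n<1+n j) j+1<q , subst (q ∣_) (+-suc n j) q∣n+j+1
... | zero , _ , q∣n+0 = q′ , n<1+n q′ ,
  subst (q ∣_) (trans (cong (_+ q) (+-identityʳ n)) (+-suc n q′)) (∣m∣n⇒∣m+n q∣n+0 ∣-refl)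

squareFree-below-2*primorial : ∀ k M → .{{NonZero M}} → k ≤ ω M → M < 2 * primorial k → SquareFree M
squareFree-below-2*primorial k M k≤ωM M<2*primorial {p} p-prime p²∣M = <⇒≱ M<2*primorial (begin
  2 * primorial k     ≤⟨ *-mono-≤ (prime⇒2≤ p-prime) (primorial-mono-≤ k≤ωM) ⟩
  p * primorial (ω M) ≤⟨ p*primorial-ω≤ M p-prime p²∣M ⟩
  M                   ∎)
  where open ≤-Reasoning

squareFree-multiple-of-primorial : ∀ k N → .{{NonZero N}} → SquareFree N → primorial k ∣ N → ω N ≤ k →
                                   N ≡ primorial k
squareFree-multiple-of-primorial k N _ (divides 0 N≡0) _ = contradiction N≡0 (≢-nonZero⁻¹ N)
squareFree-multiple-of-primorial k N _ (divides 1 N≡1*primorial) _ =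
  trans N≡1*primorial (*-identityˡ (primorial k))
squareFree-multiple-of-primorial k N squareFree primorial∣N@(divides r@(2+ _) N≡r*primorial) ωN≤k
  with p , p-prime , p∣r ← ∃-prime∣ r
  with p ∣? primorial k
... | yes p∣primorial =
  contradiction (subst (p * p ∣_) (sym N≡r*primorial) (*-pres-∣ p∣r p∣primorial)) (squareFree p-prime)
... | no p∤primorial = contradiction ωN≤k (<⇒≱ k<ωN)
  where
  p∉primesFrom : All (p ≢_) (primesFrom 0 k)
  p∉primesFrom = All.map (λ q∣primorial p≡q → p∤primorial (subst (_∣ primorial k) (sym p≡q) q∣primorial))
                         (primesFrom-∣-primorial k)
  k<ωN : k < ω N
  k<ωN = subst (_≤ ω N) (cong suc (length-primesFrom 0 k))
    (distinctPrimes∣⇒length≤ω (p∉primesFrom ∷ primesFrom-unique 0 k) (p-prime ∷ primesFrom-prime 0 k)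
      (subst (p ∣_) (sym N≡r*primorial) (∣m⇒∣m*n (primorial k) p∣r)
        ∷ primorial∣⇒primesFrom-∣ k primorial∣N))

t≡t⇒≡primorial : ∀ k N M → .{{NonZero N}} → .{{NonZero M}} →
                 t N ≡ t M → primorial k ∣ N → M < 2 * primorial k → N ≡ primorial k
t≡t⇒≡primorial k N M tN≡tM primorial∣N M<2*primorial =
  squareFree-multiple-of-primorial k N squareFree-N primorial∣N (subst (_≤ k) (sym ωN≡ωM) ωM≤k)
  where
  ωN≡ωM : ω N ≡ ω M
  ωN≡ωM = t≡t⇒ω≡ω tN≡tM
  ωM≤k : ω M ≤ k
  ωM≤k = <primorial-suc⇒ω≤ k M (<-≤-trans M<2*primorial (2*primorial≤primorial-suc k))
  squareFree-M : SquareFree M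
  squareFree-M =
    squareFree-below-2*primorial k M (subst (k ≤_) ωN≡ωM (primorial∣⇒≤ω k primorial∣N)) M<2*primorial
  squareFree-N : SquareFree N
  squareFree-N = star⇒squareFree (subst Star (sym tN≡tM) (squareFree⇒star squareFree-M))

t≡t⇒primorial≤ : ∀ k X Y → .{{NonZero X}} → .{{NonZero Y}} →
                 t X ≡ t Y → primorial k ∣ Y → primorial k ≤ X
t≡t⇒primorial≤ k X Y tX≡tY primorial∣Y =
  ≤-trans (primorial-mono-≤ (subst (k ≤_) (sym (t≡t⇒ω≡ω tX≡tY)) (primorial∣⇒≤ω k primorial∣Y)))
          (primorial-ω≤ X)

lemma4 : ∀ (k : ℕ) → 2 ≤ k → ∀ (n : ℕ) → 1 ≤ n →
    (∀ (j : ℕ) → j < primorial k → t (n + j) ≡ t (primorial k + j)) →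
    n ≡ primorial k
-- The argument does not need 2 ≤ k.
lemma4 k _ n 1≤n t-agrees with j , j<q , q∣n+j ← ∃-shift-to-multiple (primorial k) {{primorial≢0 k}} n =
  ≤-antisym n≤q q≤n
  where
  q = primorial k
  instance
    _ = primorial≢0 k
    _ = >-nonZero 1≤n
  q+j<2*q : q + j < 2 * q
  q+j<2*q = +-monoʳ-< q (subst (j <_) (sym (+-identityʳ q)) j<q)
  n+j≡q : n + j ≡ q
  n+j≡q = t≡t⇒≡primorial k (n + j) (q + j) {{m≢0⇒m+n≢0 n j}} {{m≢0⇒m+n≢0 q j}}
            (t-agrees j j<q) q∣n+j q+j<2*q
  n≤q : n ≤ q
  n≤q = subst (n ≤_) n+j≡q (m≤m+n n j)
  tn≡tq : t n ≡ t q
  tn≡tq = subst₂ (λ a b → t a ≡ t b) (+-identityʳ n) (+-identityʳ q) (t-agrees 0 (>-nonZero⁻¹ q))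
  q≤n : q ≤ n
  q≤n = t≡t⇒primorial≤ k n q tn≡tq ∣-refl
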